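{- Let $q$ be a prime power, $d$ a positive integer, $f=x^d\in\mathbb{F}_q[x]$ and $m=\gcd(d,q-1)$. If $m(m-1)\ge q-1$, then $\deg(S_f)=m$.
   Context: $\mathrm{PG}(2,q)$ is the projective plane over $\mathbb{F}_q$. For $f\in\mathbb{F}_q[x]$, $S_f=\{(x,f(x),1):x\in\mathbb{F}_q\}\cup\{(0,1,0)\}$. For a set $D$ of $q+1$ points, $u_i(D)$ is the number of lines of $\mathrm{PG}(2,q)$ containing exactly $i$ points of $D$, and $\deg(D)$ is the largest $i$ with $u_i(D)\neq 0$. -}

module Defs where

open import Level using (0ℓ)
open import Data.Nat using (ℕ; zero; suc; _≤_; _⊔_)
open import Data.Nat.Primality using (Prime)
open import Data.Fin using (Fin)
open import Data.List using (List; []; _∷_; map; length; filter; concatMap; foldr; _++_; allFin)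
open import Data.Product using (Σ; ∃; _×_; _,_)
open import Relation.Binary.PropositionalEquality using (_≡_; _≢_)
open import Relation.Nullary using (Dec; yes; no)
open import Relation.Binary.Definitions using (DecidableEquality)
open import Algebra.Structures using (IsCommutativeRing)
open import Function.Bundles using (_↔_; Inverse)

IsPrimePower : ℕ → Set
IsPrimePower q = Σ ℕ λ p → Σ ℕ λ k → Prime p × (1 ≤ k) × (q ≡ p Data.Nat.^ k)

record FiniteField (q : ℕ) : Set₁ where
  field
    Carrier   : Set
    _≟_       : DecidableEquality Carrier
    _+_ _*_   : Carrier → Carrier → Carrier
    -_        : Carrier → Carrier
    0# 1#     : Carrier
    isCommutativeRing : IsCommutativeRing _≡_ _+_ _*_ -_ 0# 1#
    0≢1       : 0# ≢ 1#
    inverse   : ∀ x → x ≢ 0# → ∃ λ y → x * y ≡ 1#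
    enumeration : Fin q ↔ Carrier

  infixl 6 _+_
  infixl 7 _*_

  elements : List Carrier
  elements = map (Inverse.to enumeration) (allFin q)

  _^_ : Carrier → ℕ → Carrier
  x ^ zero  = 1#
  x ^ suc n = x * (x ^ n)

  -- homogeneous coordinates (X , Y , Z)
  Triple : Set
  Triple = Carrier × Carrier × Carrier

  incident : Triple → Triple → Set
  incident (a , b , c) (x , y , z) = a * x + b * y + c * z ≡ 0#

  incident? : (ℓ P : Triple) → Dec (incident ℓ P)
  incident? (a , b , c) (x , y , z) = (a * x + b * y + c * z) ≟ 0#

  -- the q²+q+1 lines of PG(2,q), each given once by its normalised
  -- coordinates [1,b,c], [0,1,c], [0,0,1]
  lines : List Triple
  lines = concatMap (λ b → map (λ c → (1# , b , c)) elements) elements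
       ++ map (λ c → (0# , 1# , c)) elements
       ++ ((0# , 0# , 1#) ∷ [])

  -- a point set D given as a list of (pairwise distinct projective) points;
  -- number of points of D on line ℓ
  pointsOn : List Triple → Triple → ℕ
  pointsOn D ℓ = length (filter (incident? ℓ) D)

  u : List Triple → ℕ → ℕ
  u D i = length (filter (λ ℓ → Data.Nat._≟_ (pointsOn D ℓ) i) lines)

  -- deg(D): largest i with u_i(D) ≠ 0, i.e. the maximum of pointsOn D ℓ over all lines
  deg : List Triple → ℕ
  deg D = foldr (λ ℓ r → pointsOn D ℓ ⊔ r) 0 lines

  S : (Carrier → Carrier) → List Triple
  S f = map (λ x → (x , f x , 1#)) elements ++ ((0# , 1# , 0#) ∷ [])

module Submission where

-- Write m = gcd d (q - 1) and q - 1 = k m; the hypothesis m (m - 1) ≥ q - 1 says exactly k < m.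
-- The points of S_f on a horizontal line y = e form a fibre of x ↦ xᵈ. By Bézout xᵈ determines xᵐ,
-- so such a fibre consists of roots of Xᵐ - x₀ᵐ and has at most m points. On a line x + b y + c = 0
-- with b ≠ 0 a point is determined by y = xᵈ, and y satisfies y^(k+1) = y by Fermat's little theorem,
-- so there are at most k + 1 ≤ m of them; the remaining lines carry at most 2 ≤ m points. Conversely
-- x ↦ xᵈ maps the q - 1 units into the at most k solutions of yᵏ = 1, so by pigeonhole some
-- horizontal line contains at least m points.

open import Level using (0ℓ)
open import Function.Base using (_∘_; id)
open import Data.Empty using (⊥-elim)
open import Data.Nat as ℕ using (ℕ; zero; suc; z≤n; s≤s; _≤_; _<_; _≥_; _∸_; _⊔_)
import Data.Nat.Properties as ℕ
open import Data.Nat.Divisibility using (_∣_; divides; *-monoˡ-∣)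
open import Data.Nat.GCD using (gcd; gcd[m,n]∣m; gcd[m,n]∣n; gcd-GCD; module Bézout)
open import Data.Product using (∃; _,_; proj₁; proj₂)
open import Data.Vec using (Vec; []; _∷_; replicate)
open import Data.List using (List; []; _∷_; map; length; filter; foldr; concatMap; _++_; allFin)
open import Data.List.Properties using (length-filter; filter-++; length-++; length-map; length-tabulate; map-∘; map-id-local; filter-reject; filter-all)
open import Data.List.Membership.Propositional using (_∈_)
open import Data.List.Membership.Propositional.Properties using (∈-map⁺; ∈-map⁻; ∈-filter⁺; ∈-filter⁻; ∈-++⁺ˡ; ∈-++⁺ʳ; ∈-allFin; ∈-length)
open import Data.List.Membership.Propositional.Properties.WithK using (unique∧set⇒bag)
open import Data.List.Relation.Unary.Any as Any using (here; there)
open import Data.List.Relation.Unary.All as All using (All; []; _∷_)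
open import Data.List.Relation.Unary.All.Properties as Allₚ using (all-filter; ++⁺; map⁺; concat⁺)
open import Data.List.Relation.Unary.AllPairs using (_∷_)
open import Data.List.Relation.Unary.Unique.Propositional using (Unique)
import Data.List.Relation.Unary.Unique.Propositional.Properties as Unique
open import Data.List.Relation.Binary.Sublist.Propositional using (⊆-refl)
open import Data.List.Relation.Binary.Sublist.Propositional.Properties using (filter⁺; filter-⊆; length-mono-≤)
open import Data.List.Relation.Binary.BagAndSetEquality using (∼bag⇒↭)
open import Data.List.Relation.Binary.Permutation.Propositional using (_↭_; ↭⇒↭ₛ′)
import Data.List.Relation.Binary.Permutation.Setoid.Properties as PermutationSetoid
open import Relation.Nullary using (yes; no; ¬_; ¬?)
open import Relation.Unary using (Decidable)
open import Relation.Binary.Definitions using (DecidableEquality)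
open import Relation.Binary.PropositionalEquality
open import Function.Bundles using (Inverse; Injection; mk⇔)
open import Function.Properties.Inverse using (Inverse⇒Injection)
open import Algebra.Bundles using (CommutativeRing)

open import Defs

k*m≤m*[m∸1]⇒k<m : ∀ k m → 0 < k ℕ.* m → k ℕ.* m ≤ m ℕ.* (m ∸ 1) → k < m
k*m≤m*[m∸1]⇒k<m k zero 0<k*0 _ = ⊥-elim (ℕ.<⇒≢ 0<k*0 (sym (ℕ.*-zeroʳ k)))
k*m≤m*[m∸1]⇒k<m k (suc m) _ km≤[m+1]m =
  s≤s (ℕ.*-cancelʳ-≤ k m (suc m) (subst (k ℕ.* suc m ≤_) (ℕ.*-comm (suc m) m) km≤[m+1]m))

-- Counting in lists

module _ {A B : Set} {P : B → Set} (P? : Decidable P) (f : A → B) where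

  length-filter-map : ∀ xs → length (filter P? (map f xs)) ≡ length (filter (P? ∘ f) xs)
  length-filter-map [] = refl
  length-filter-map (x ∷ xs) with P? (f x)
  ... | yes _ = cong suc (length-filter-map xs)
  ... | no _ = length-filter-map xs

module _ {A : Set} {P Q : A → Set} (P? : Decidable P) (Q? : Decidable Q) where

  length-filter-mono : (∀ {x} → P x → Q x) → ∀ xs → length (filter P? xs) ≤ length (filter Q? xs)
  length-filter-mono P⇒Q xs = length-mono-≤ (filter⁺ P? Q? (λ { refl → P⇒Q }) (⊆-refl {x = xs}))

  length-filter-filter : ∀ xs → length (filter P? (filter Q? xs)) ≤ length (filter P? xs)
  length-filter-filter xs = length-mono-≤ (filter⁺ P? P? (λ { refl → id }) (filter-⊆ Q? xs))

module _ {A : Set} {P : A → Set} (P? : Decidable P) where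

  length-filter-partition : ∀ xs → length (filter P? xs) ℕ.+ length (filter (¬? ∘ P?) xs) ≡ length xs
  length-filter-partition [] = refl
  length-filter-partition (x ∷ xs) with P? x
  ... | yes _ = cong suc (length-filter-partition xs)
  ... | no _ = trans (ℕ.+-suc _ _) (cong suc (length-filter-partition xs))

module _ {A : Set} (_≟_ : DecidableEquality A) where

  length-filter-≢ : ∀ {a xs} → Unique xs → a ∈ xs → suc (length (filter (λ x → ¬? (x ≟ a)) xs)) ≡ length xs
  length-filter-≢ {a} {x ∷ xs} (x∉xs ∷ u) a∈x∷xs with x ≟ a
  ... | yes refl = cong (suc ∘ length) (filter-all _ (All.map ≢-sym x∉xs))
  ... | no x≢a = cong suc (length-filter-≢ u (Any.tail (x≢a ∘ sym) a∈x∷xs))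

module _ {A B : Set} (_≟_ : DecidableEquality B) (g : A → B) where

  fibre : B → List A → List A
  fibre y = filter (λ x → g x ≟ y)

  pigeonhole : ∀ n ys xs → All (λ x → g x ∈ ys) xs → length ys ℕ.* n < length xs →
               ∃ λ y → n < length (fibre y xs)
  pigeonhole n [] [] [] ()
  pigeonhole n (y ∷ ys) xs g[xs]⊆ lt with n ℕ.<? length (fibre y xs)
  ... | yes large = y , large
  ... | no small =
    let (y′ , large) = pigeonhole n ys rest g[rest]⊆ rest-large
    in y′ , ℕ.<-≤-trans large (length-filter-filter _ _ xs)
    where
      rest : List A
      rest = filter (λ x → ¬? (g x ≟ y)) xs

      g[rest]⊆ : All (λ x → g x ∈ ys) rest
      g[rest]⊆ = All.zipWith (λ (g[x]∈ , g[x]≢y) → Any.tail g[x]≢y g[x]∈)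
                   (Allₚ.filter⁺ _ g[xs]⊆ , all-filter _ xs)

      rest-large : length ys ℕ.* n < length rest
      rest-large = ℕ.+-cancelˡ-< n _ _ (begin-strict
        n ℕ.+ length ys ℕ.* n                      <⟨ lt ⟩
        length xs                                  ≡⟨ sym (length-filter-partition _ xs) ⟩
        length (fibre y xs) ℕ.+ length rest        ≤⟨ ℕ.+-monoˡ-≤ _ (ℕ.≮⇒≥ small) ⟩
        n ℕ.+ length rest                          ∎)
        where open ℕ.≤-Reasoning

module _ {A : Set} (f : A → ℕ) where

  foldr-⊔-lub : ∀ {n xs} → All (λ x → f x ≤ n) xs → foldr (λ x r → f x ⊔ r) 0 xs ≤ n
  foldr-⊔-lub [] = z≤n
  foldr-⊔-lub (fx≤n ∷ fxs≤n) = ℕ.⊔-lub fx≤n (foldr-⊔-lub fxs≤n)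

  foldr-⊔-upper : ∀ {x xs} → x ∈ xs → f x ≤ foldr (λ x r → f x ⊔ r) 0 xs
  foldr-⊔-upper (here refl) = ℕ.m≤m⊔n _ _
  foldr-⊔-upper {xs = y ∷ _} (there x∈xs) = ℕ.≤-trans (foldr-⊔-upper x∈xs) (ℕ.m≤n⊔m (f y) _)

module _ {q : ℕ} (F : FiniteField q) where

  open FiniteField F

  ring : CommutativeRing 0ℓ 0ℓ
  ring = record { isCommutativeRing = isCommutativeRing }

  open CommutativeRing ring using (+-identityˡ; +-identityʳ; *-identityˡ; *-identityʳ; zeroˡ; zeroʳ;
    -‿inverseˡ; -‿inverseʳ; *-comm; *-assoc; +-group; *-isCommutativeMonoid)
  open import Algebra.Solver.Ring.NaturalCoefficients.Default (CommutativeRing.commutativeSemiring ring)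
    using (solve; _:+_; _:*_; _:=_; con)
  open import Algebra.Properties.Group +-group using (inverseˡ-unique)

  -- Finite fields

  1≢0 : 1# ≢ 0#
  1≢0 1≡0 = 0≢1 (sym 1≡0)

  *-cancelʳ : ∀ {x y z} → z ≢ 0# → x * z ≡ y * z → x ≡ y
  *-cancelʳ {x} {y} {z} z≢0 xz≡yz with inverse z z≢0
  ... | z⁻¹ , zz⁻¹≡1 = begin
    x              ≡⟨ sym (*-identityʳ x) ⟩
    x * 1#         ≡⟨ cong (x *_) (sym zz⁻¹≡1) ⟩
    x * (z * z⁻¹)  ≡⟨ sym (*-assoc x z z⁻¹) ⟩
    x * z * z⁻¹    ≡⟨ cong (_* z⁻¹) xz≡yz ⟩
    y * z * z⁻¹    ≡⟨ *-assoc y z z⁻¹ ⟩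
    y * (z * z⁻¹)  ≡⟨ cong (y *_) zz⁻¹≡1 ⟩
    y * 1#         ≡⟨ *-identityʳ y ⟩
    y              ∎
    where open ≡-Reasoning

  *-≢0 : ∀ {x y} → x ≢ 0# → y ≢ 0# → x * y ≢ 0#
  *-≢0 {x} {y} x≢0 y≢0 xy≡0 = x≢0 (*-cancelʳ y≢0 (trans xy≡0 (sym (zeroˡ y))))

  x+y≡0⇒x≡-y : ∀ {x y} → x + y ≡ 0# → x ≡ - y
  x+y≡0⇒x≡-y = inverseˡ-unique _ _

  x≢0⇒x^n≢0 : ∀ {x} n → x ≢ 0# → x ^ n ≢ 0#
  x≢0⇒x^n≢0 zero x≢0 = 1≢0
  x≢0⇒x^n≢0 (suc n) x≢0 = *-≢0 x≢0 (x≢0⇒x^n≢0 n x≢0)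

  x^n≡0⇒x≡0 : ∀ {x} n → x ^ n ≡ 0# → x ≡ 0#
  x^n≡0⇒x≡0 {x} n xⁿ≡0 with x ≟ 0#
  ... | yes x≡0 = x≡0
  ... | no x≢0 = ⊥-elim (x≢0⇒x^n≢0 n x≢0 xⁿ≡0)

  1^n≡1 : ∀ n → 1# ^ n ≡ 1#
  1^n≡1 zero = refl
  1^n≡1 (suc n) = trans (*-identityˡ _) (1^n≡1 n)

  ^-homo-* : ∀ x m n → x ^ (m ℕ.+ n) ≡ x ^ m * x ^ n
  ^-homo-* x zero n = sym (*-identityˡ _)
  ^-homo-* x (suc m) n = trans (cong (x *_) (^-homo-* x m n)) (sym (*-assoc x _ _))

  ^-assocʳ : ∀ x m n → (x ^ m) ^ n ≡ x ^ (m ℕ.* n)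
  ^-assocʳ x m zero = cong (x ^_) (sym (ℕ.*-zeroʳ m))
  ^-assocʳ x m (suc n) = begin
    x ^ m * (x ^ m) ^ n      ≡⟨ cong (x ^ m *_) (^-assocʳ x m n) ⟩
    x ^ m * x ^ (m ℕ.* n)    ≡⟨ sym (^-homo-* x m (m ℕ.* n)) ⟩
    x ^ (m ℕ.+ m ℕ.* n)      ≡⟨ cong (x ^_) (sym (ℕ.*-suc m n)) ⟩
    x ^ (m ℕ.* suc n)        ∎
    where open ≡-Reasoning

  elements-unique : Unique elements
  elements-unique = Unique.map⁺ (Injection.injective (Inverse⇒Injection enumeration)) (Unique.allFin⁺ q)

  ∈-elements : ∀ x → x ∈ elements
  ∈-elements x = subst (_∈ elements) (strictlyInverseˡ x) (∈-map⁺ to (∈-allFin (from x)))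
    where open Inverse enumeration using (to; from; strictlyInverseˡ)

  length-elements : length elements ≡ q
  length-elements = trans (length-map _ (allFin q)) (length-tabulate id)

  nonzero? : Decidable (_≢ 0#)
  nonzero? x = ¬? (x ≟ 0#)

  units : List Carrier
  units = filter nonzero? elements

  ∈-units : ∀ {x} → x ≢ 0# → x ∈ units
  ∈-units x≢0 = ∈-filter⁺ nonzero? (∈-elements _) x≢0

  units-unique : Unique units
  units-unique = Unique.filter⁺ nonzero? elements-unique

  units-≢0 : ∀ {x} → x ∈ units → x ≢ 0#
  units-≢0 x∈units = proj₂ (∈-filter⁻ nonzero? {xs = elements} x∈units)

  length-units : length units ≡ q ∸ 1
  length-units = cong (_∸ 1) (trans (length-filter-≢ _≟_ elements-unique (∈-elements 0#)) length-elements)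

  q∸1≥1 : 1 ≤ q ∸ 1
  q∸1≥1 = subst (1 ≤_) length-units (∈-length (∈-units 1≢0))

  ∏ : List Carrier → Carrier
  ∏ = foldr _*_ 1#

  ∏-↭ : ∀ {xs ys} → xs ↭ ys → ∏ xs ≡ ∏ ys
  ∏-↭ xs↭ys = PermutationSetoid.foldr-commMonoid (setoid Carrier) *-isCommutativeMonoid (↭⇒↭ₛ′ isEquivalence xs↭ys)

  ∏-map-* : ∀ a xs → ∏ (map (a *_) xs) ≡ a ^ length xs * ∏ xs
  ∏-map-* a [] = sym (*-identityʳ 1#)
  ∏-map-* a (x ∷ xs) = trans (cong (a * x *_) (∏-map-* a xs))
    (solve 4 (λ a x aⁿ p → a :* x :* (aⁿ :* p) := a :* aⁿ :* (x :* p)) refl a x (a ^ length xs) (∏ xs))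

  ∏-≢0 : ∀ {xs} → All (_≢ 0#) xs → ∏ xs ≢ 0#
  ∏-≢0 [] = 1≢0
  ∏-≢0 (x≢0 ∷ xs≢0) = *-≢0 x≢0 (∏-≢0 xs≢0)

  map-*-units↭units : ∀ {a} → a ≢ 0# → map (a *_) units ↭ units
  map-*-units↭units {a} a≢0 with inverse a a≢0
  ... | a⁻¹ , aa⁻¹≡1 = ∼bag⇒↭ (unique∧set⇒bag scaled-unique units-unique (mk⇔ scaled⊆units units⊆scaled))
    where
      scaled-unique : Unique (map (a *_) units)
      scaled-unique = Unique.map⁺ (λ {x} {y} ax≡ay → *-cancelʳ a≢0 (trans (*-comm x a) (trans ax≡ay (*-comm a y))))
                                  units-unique
      scaled⊆units : ∀ {z} → z ∈ map (a *_) units → z ∈ units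
      scaled⊆units z∈ with ∈-map⁻ (a *_) z∈
      ... | x , x∈units , refl = ∈-units (*-≢0 a≢0 (units-≢0 x∈units))
      units⊆scaled : ∀ {z} → z ∈ units → z ∈ map (a *_) units
      units⊆scaled {z} z∈units = subst (_∈ map (a *_) units) a[a⁻¹z]≡z (∈-map⁺ (a *_) (∈-units a⁻¹z≢0))
        where
          a[a⁻¹z]≡z : a * (a⁻¹ * z) ≡ z
          a[a⁻¹z]≡z = trans (sym (*-assoc a a⁻¹ z)) (trans (cong (_* z) aa⁻¹≡1) (*-identityˡ z))
          a⁻¹z≢0 : a⁻¹ * z ≢ 0#
          a⁻¹z≢0 a⁻¹z≡0 = units-≢0 z∈units (trans (sym a[a⁻¹z]≡z) (trans (cong (a *_) a⁻¹z≡0) (zeroʳ a)))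

  -- Multiplication by a permutes the units, so a ^ (q - 1) times their product is their product.
  fermat : ∀ {a} → a ≢ 0# → a ^ (q ∸ 1) ≡ 1#
  fermat {a} a≢0 = subst (λ n → a ^ n ≡ 1#) length-units (*-cancelʳ (∏-≢0 (all-filter nonzero? elements)) (begin
    a ^ length units * ∏ units  ≡⟨ sym (∏-map-* a units) ⟩
    ∏ (map (a *_) units)        ≡⟨ ∏-↭ (map-*-units↭units a≢0) ⟩
    ∏ units                     ≡⟨ sym (*-identityˡ _) ⟩
    1# * ∏ units                ∎))
    where open ≡-Reasoning

  q∸1∣n⇒x^n≡1 : ∀ {x n} → x ≢ 0# → (q ∸ 1) ∣ n → x ^ n ≡ 1#
  q∸1∣n⇒x^n≡1 {x} x≢0 (divides c refl) = begin
    x ^ (c ℕ.* (q ∸ 1))      ≡⟨ cong (x ^_) (ℕ.*-comm c (q ∸ 1)) ⟩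
    x ^ ((q ∸ 1) ℕ.* c)      ≡⟨ sym (^-assocʳ x (q ∸ 1) c) ⟩
    (x ^ (q ∸ 1)) ^ c        ≡⟨ cong (_^ c) (fermat x≢0) ⟩
    1# ^ c                   ≡⟨ 1^n≡1 c ⟩
    1#                       ∎
    where open ≡-Reasoning

  -- Monic polynomials

  -- c₀ ∷ … ∷ cₙ₋₁ ∷ [] stands for the monic polynomial xⁿ + cₙ₋₁ xⁿ⁻¹ + … + c₀.
  evalMonic : ∀ {n} → Vec Carrier n → Carrier → Carrier
  evalMonic [] x = 1#
  evalMonic (c ∷ cs) x = c + x * evalMonic cs x

  divideByLinear : ∀ {n} → Vec Carrier (suc n) → Carrier → Vec Carrier n
  divideByLinear (c ∷ []) r = []
  divideByLinear (c ∷ c′ ∷ cs) r = evalMonic (c′ ∷ cs) r ∷ divideByLinear (c′ ∷ cs) r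

  -- p x = (x - r) · (p / (x - r)) x + p r, with both sides moved so that no subtraction occurs.
  evalMonic-divideByLinear : ∀ {n} (p : Vec Carrier (suc n)) r x →
    evalMonic p x + r * evalMonic (divideByLinear p r) x ≡ x * evalMonic (divideByLinear p r) x + evalMonic p r
  evalMonic-divideByLinear (c ∷ []) r x =
    solve 3 (λ c x r → c :+ x :* con 1 :+ r :* con 1 := x :* con 1 :+ (c :+ r :* con 1)) refl c x r
  evalMonic-divideByLinear (c ∷ c′ ∷ cs) r x = begin
    c + x * px + r * (pr + x * qx)   ≡⟨ solve 6 (λ c x px r pr qx → c :+ x :* px :+ r :* (pr :+ x :* qx)
                                                   := c :+ r :* pr :+ x :* (px :+ r :* qx)) refl c x px r pr qx ⟩
    c + r * pr + x * (px + r * qx)   ≡⟨ cong (λ t → c + r * pr + x * t) (evalMonic-divideByLinear (c′ ∷ cs) r x) ⟩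
    c + r * pr + x * (x * qx + pr)   ≡⟨ solve 5 (λ c x r pr qx → c :+ r :* pr :+ x :* (x :* qx :+ pr)
                                                   := x :* (pr :+ x :* qx) :+ (c :+ r :* pr)) refl c x r pr qx ⟩
    x * (pr + x * qx) + (c + r * pr) ∎
    where
      open ≡-Reasoning
      px = evalMonic (c′ ∷ cs) x
      pr = evalMonic (c′ ∷ cs) r
      qx = evalMonic (divideByLinear (c′ ∷ cs) r) x

  IsRoot : ∀ {n} → Vec Carrier n → Carrier → Set
  IsRoot p x = evalMonic p x ≡ 0#

  root-of-quotient : ∀ {n} (p : Vec Carrier (suc n)) {r x} → x ≢ r → IsRoot p r → IsRoot p x →
                     IsRoot (divideByLinear p r) x
  root-of-quotient p {r} {x} x≢r pr≡0 px≡0 with evalMonic (divideByLinear p r) x ≟ 0#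
  ... | yes qx≡0 = qx≡0
  ... | no qx≢0 = ⊥-elim (x≢r (*-cancelʳ qx≢0 (begin
    x * qx         ≡⟨ sym (+-identityʳ _) ⟩
    x * qx + 0#    ≡⟨ cong (x * qx +_) (sym pr≡0) ⟩
    x * qx + evalMonic p r  ≡⟨ sym (evalMonic-divideByLinear p r x) ⟩
    evalMonic p x + r * qx  ≡⟨ cong (_+ r * qx) px≡0 ⟩
    0# + r * qx    ≡⟨ +-identityˡ _ ⟩
    r * qx         ∎)))
    where
      open ≡-Reasoning
      qx = evalMonic (divideByLinear p r) x

  roots-≤-degree : ∀ {n} (p : Vec Carrier n) {xs} → Unique xs → All (IsRoot p) xs → length xs ≤ n
  roots-≤-degree _ _ [] = z≤n
  roots-≤-degree [] _ (1≡0 ∷ _) = ⊥-elim (1≢0 1≡0)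
  roots-≤-degree p@(_ ∷ _) (r∉xs ∷ xs-unique) (pr≡0 ∷ xs-roots) =
    s≤s (roots-≤-degree (divideByLinear p _) xs-unique
      (All.zipWith (λ (r≢x , px≡0) → root-of-quotient p (r≢x ∘ sym) pr≡0 px≡0) (r∉xs , xs-roots)))

  evalMonic-replicate-0# : ∀ n x → evalMonic (replicate n 0#) x ≡ x ^ n
  evalMonic-replicate-0# zero x = refl
  evalMonic-replicate-0# (suc n) x = trans (+-identityˡ _) (cong (x *_) (evalMonic-replicate-0# n x))

  ^-solutions-≤ : ∀ {n} → 1 ≤ n → ∀ c {xs} → Unique xs → All (λ x → x ^ n ≡ c) xs → length xs ≤ n
  ^-solutions-≤ {suc n} _ c xs-unique solutions = roots-≤-degree ((- c) ∷ replicate n 0#) xs-unique (All.map root solutions)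
    where
      root : ∀ {x} → x ^ suc n ≡ c → IsRoot ((- c) ∷ replicate n 0#) x
      root {x} xⁿ⁺¹≡c = begin
        - c + x * evalMonic (replicate n 0#) x  ≡⟨ cong (λ t → - c + x * t) (evalMonic-replicate-0# n x) ⟩
        - c + x ^ suc n                         ≡⟨ cong (- c +_) xⁿ⁺¹≡c ⟩
        - c + c                                 ≡⟨ -‿inverseˡ c ⟩
        0#                                      ∎
        where open ≡-Reasoning

  ^-fixedPoints-≤ : ∀ {n} → 1 ≤ n → ∀ {ys} → Unique ys → All (λ y → y ^ suc n ≡ y) ys → length ys ≤ suc n
  ^-fixedPoints-≤ {suc n} _ ys-unique fixed = roots-≤-degree (0# ∷ (- 1#) ∷ replicate n 0#) ys-unique (All.map root fixed)
    where
      root : ∀ {y} → y ^ suc (suc n) ≡ y → IsRoot (0# ∷ (- 1#) ∷ replicate n 0#) y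
      root {y} yⁿ⁺²≡y = begin
        0# + y * (- 1# + y * evalMonic (replicate n 0#) y)  ≡⟨ cong (λ t → 0# + y * (- 1# + y * t)) (evalMonic-replicate-0# n y) ⟩
        0# + y * (- 1# + y ^ suc n)                         ≡⟨ solve 3 (λ y m w → con 0 :+ y :* (m :+ w) := y :* w :+ y :* m)
                                                                      refl y (- 1#) (y ^ suc n) ⟩
        y ^ suc (suc n) + y * - 1#                          ≡⟨ cong (_+ y * - 1#) yⁿ⁺²≡y ⟩
        y + y * - 1#                                        ≡⟨ solve 2 (λ y m → y :+ y :* m := y :* (con 1 :+ m)) refl y (- 1#) ⟩
        y * (1# + - 1#)                                     ≡⟨ cong (y *_) (-‿inverseʳ 1#) ⟩
        y * 0#                                              ≡⟨ zeroʳ y ⟩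
        0#                                                  ∎
        where open ≡-Reasoning

  -- Points of S f on the lines of PG(2, q)

  ∞ : Triple
  ∞ = 0# , 1# , 0#

  affinePointsOn : (Carrier → Carrier) → Triple → ℕ
  affinePointsOn f ℓ = length (filter (λ x → incident? ℓ (x , f x , 1#)) elements)

  pointsOn-S : ∀ f ℓ → pointsOn (S f) ℓ ≡ affinePointsOn f ℓ ℕ.+ length (filter (incident? ℓ) (∞ ∷ []))
  pointsOn-S f ℓ = begin
    length (filter on? (map point elements ++ ∞ ∷ []))                         ≡⟨ cong length (filter-++ on? (map point elements) (∞ ∷ [])) ⟩
    length (filter on? (map point elements) ++ filter on? (∞ ∷ []))            ≡⟨ length-++ (filter on? (map point elements)) ⟩
    length (filter on? (map point elements)) ℕ.+ length (filter on? (∞ ∷ []))  ≡⟨ cong (ℕ._+ _) (length-filter-map on? point elements) ⟩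
    affinePointsOn f ℓ ℕ.+ length (filter on? (∞ ∷ []))                        ∎
    where
      open ≡-Reasoning
      on? = incident? ℓ
      point : Carrier → Triple
      point x = x , f x , 1#

  pointsOn-S-≤ : ∀ f ℓ → pointsOn (S f) ℓ ≤ affinePointsOn f ℓ ℕ.+ 1
  pointsOn-S-≤ f ℓ = ℕ.≤-trans (ℕ.≤-reflexive (pointsOn-S f ℓ)) (ℕ.+-monoʳ-≤ _ (length-filter (incident? ℓ) (∞ ∷ [])))

  pointsOn-S-∞∉ : ∀ f ℓ → ¬ incident ℓ ∞ → pointsOn (S f) ℓ ≡ affinePointsOn f ℓ
  pointsOn-S-∞∉ f ℓ ∞∉ℓ = begin
    pointsOn (S f) ℓ                                            ≡⟨ pointsOn-S f ℓ ⟩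
    affinePointsOn f ℓ ℕ.+ length (filter (incident? ℓ) (∞ ∷ []))  ≡⟨ cong (λ xs → affinePointsOn f ℓ ℕ.+ length xs)
                                                                      (filter-reject (incident? ℓ) {xs = []} ∞∉ℓ) ⟩
    affinePointsOn f ℓ ℕ.+ 0                                     ≡⟨ ℕ.+-identityʳ _ ⟩
    affinePointsOn f ℓ                                          ∎
    where open ≡-Reasoning

  affinePointsOn-≤-pointsOn : ∀ f ℓ → affinePointsOn f ℓ ≤ pointsOn (S f) ℓ
  affinePointsOn-≤-pointsOn f ℓ = ℕ.≤-trans (ℕ.m≤m+n _ _) (ℕ.≤-reflexive (sym (pointsOn-S f ℓ)))

  affinePointsOn-≤ : ∀ f ℓ {n} → (∀ {xs} → Unique xs → All (λ x → incident ℓ (x , f x , 1#)) xs → length xs ≤ n) →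
                     affinePointsOn f ℓ ≤ n
  affinePointsOn-≤ f ℓ bound = bound (Unique.filter⁺ _ elements-unique) (all-filter _ elements)

  affinePointsOn-≤-degree : ∀ f ℓ {n} (p : Vec Carrier n) → (∀ {x} → incident ℓ (x , f x , 1#) → IsRoot p x) →
                            affinePointsOn f ℓ ≤ n
  affinePointsOn-≤-degree f ℓ p on⇒root = affinePointsOn-≤ f ℓ (λ xs-unique on → roots-≤-degree p xs-unique (All.map on⇒root on))

  incident-affine : ∀ {a b c x y} → incident (a , b , c) (x , y , 1#) → a * x + b * y + c ≡ 0#
  incident-affine {a} {b} {c} {x} {y} = trans (cong (a * x + b * y +_) (sym (*-identityʳ c)))

  incident-∞ : ∀ {a b c} → incident (a , b , c) ∞ → b ≡ 0#
  incident-∞ {a} {b} {c} = trans (solve 3 (λ a b c → b := a :* con 0 :+ b :* con 1 :+ c :* con 0) refl a b c)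

  horizontal-level : ∀ {c x y} → incident (0# , 1# , c) (x , y , 1#) → y ≡ - c
  horizontal-level {c} {x} {y} on =
    x+y≡0⇒x≡-y (trans (solve 3 (λ x y c → y :+ c := con 0 :* x :+ con 1 :* y :+ c) refl x y c) (incident-affine on))

  horizontal-incident : ∀ x y → incident (0# , 1# , - y) (x , y , 1#)
  horizontal-incident x y =
    trans (solve 3 (λ x y n → con 0 :* x :+ con 1 :* y :+ n :* con 1 := y :+ n) refl x y (- y)) (-‿inverseʳ y)

  all-lines : ∀ {P : Triple → Set} → (∀ b c → P (1# , b , c)) → (∀ c → P (0# , 1# , c)) → P (0# , 0# , 1#) → All P lines
  all-lines P[1bc] P[01c] P[001] =
    ++⁺ (concat⁺ (map⁺ (All.universal (λ b → map⁺ (All.universal (P[1bc] b) elements)) elements)))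
        (++⁺ (map⁺ (All.universal P[01c] elements)) (P[001] ∷ []))

  [01c]∈lines : ∀ c → (0# , 1# , c) ∈ lines
  [01c]∈lines c = ∈-++⁺ʳ (concatMap _ elements) (∈-++⁺ˡ (∈-map⁺ _ (∈-elements c)))

  deg-≡ : ∀ {D n ℓ} → All (λ ℓ → pointsOn D ℓ ≤ n) lines → ℓ ∈ lines → n ≤ pointsOn D ℓ → deg D ≡ n
  deg-≡ {D} all≤n ℓ∈lines n≤ℓ =
    ℕ.≤-antisym (foldr-⊔-lub (pointsOn D) all≤n) (ℕ.≤-trans n≤ℓ (foldr-⊔-upper (pointsOn D) ℓ∈lines))

  -- The power map x ↦ xᵈ

  0^n≡0 : ∀ {n} → 1 ≤ n → 0# ^ n ≡ 0#
  0^n≡0 {suc n} _ = zeroˡ _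

  x^[n+b*[q∸1]]≡x^n : ∀ {x} n b → x ≢ 0# → x ^ (n ℕ.+ b ℕ.* (q ∸ 1)) ≡ x ^ n
  x^[n+b*[q∸1]]≡x^n {x} n b x≢0 = begin
    x ^ (n ℕ.+ b ℕ.* (q ∸ 1))      ≡⟨ ^-homo-* x n _ ⟩
    x ^ n * x ^ (b ℕ.* (q ∸ 1))    ≡⟨ cong (x ^ n *_) (q∸1∣n⇒x^n≡1 x≢0 (divides b refl)) ⟩
    x ^ n * 1#                     ≡⟨ *-identityʳ _ ⟩
    x ^ n                          ∎
    where open ≡-Reasoning

  x^d≡y^d⇒x^m≡y^m : ∀ {m d} → 1 ≤ d → Bézout.Identity m d (q ∸ 1) → ∀ {x y} → x ^ d ≡ y ^ d → x ^ m ≡ y ^ m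
  x^d≡y^d⇒x^m≡y^m {m} {d} 1≤d bezout {x} {y} xᵈ≡yᵈ with x ≟ 0# | y ≟ 0#
  ... | yes refl | _ = cong (_^ m) (sym (x^n≡0⇒x≡0 d (trans (sym xᵈ≡yᵈ) (0^n≡0 1≤d))))
  ... | no _ | yes refl = cong (_^ m) (x^n≡0⇒x≡0 d (trans xᵈ≡yᵈ (0^n≡0 1≤d)))
  ... | no x≢0 | no y≢0 = by bezout
    where
      by : Bézout.Identity m d (q ∸ 1) → x ^ m ≡ y ^ m
      by (Bézout.+- a b m+b[q∸1]≡ad) = trans (z^m≡[z^d]^a x≢0) (trans (cong (_^ a) xᵈ≡yᵈ) (sym (z^m≡[z^d]^a y≢0)))
        where
          z^m≡[z^d]^a : ∀ {z} → z ≢ 0# → z ^ m ≡ (z ^ d) ^ a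
          z^m≡[z^d]^a {z} z≢0 = begin
            z ^ m                      ≡⟨ sym (x^[n+b*[q∸1]]≡x^n m b z≢0) ⟩
            z ^ (m ℕ.+ b ℕ.* (q ∸ 1))  ≡⟨ cong (z ^_) (trans m+b[q∸1]≡ad (ℕ.*-comm a d)) ⟩
            z ^ (d ℕ.* a)              ≡⟨ sym (^-assocʳ z d a) ⟩
            (z ^ d) ^ a                ∎
            where open ≡-Reasoning
      by (Bézout.-+ a b m+ad≡b[q∸1]) = *-cancelʳ (x≢0⇒x^n≢0 a (x≢0⇒x^n≢0 d x≢0)) (begin
          x ^ m * (x ^ d) ^ a  ≡⟨ z^m*[z^d]^a≡1 x≢0 ⟩
          1#                   ≡⟨ sym (z^m*[z^d]^a≡1 y≢0) ⟩
          y ^ m * (y ^ d) ^ a  ≡⟨ cong (λ t → y ^ m * t ^ a) (sym xᵈ≡yᵈ) ⟩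
          y ^ m * (x ^ d) ^ a  ∎)
        where
          open ≡-Reasoning
          z^m*[z^d]^a≡1 : ∀ {z} → z ≢ 0# → z ^ m * (z ^ d) ^ a ≡ 1#
          z^m*[z^d]^a≡1 {z} z≢0 = begin
            z ^ m * (z ^ d) ^ a        ≡⟨ cong (z ^ m *_) (^-assocʳ z d a) ⟩
            z ^ m * z ^ (d ℕ.* a)      ≡⟨ sym (^-homo-* z m (d ℕ.* a)) ⟩
            z ^ (m ℕ.+ d ℕ.* a)        ≡⟨ cong (λ n → z ^ (m ℕ.+ n)) (ℕ.*-comm d a) ⟩
            z ^ (m ℕ.+ a ℕ.* d)        ≡⟨ cong (z ^_) m+ad≡b[q∸1] ⟩
            z ^ (b ℕ.* (q ∸ 1))        ≡⟨ q∸1∣n⇒x^n≡1 z≢0 (divides b refl) ⟩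
            1#                         ∎

  [x^d]^k≡1 : ∀ {d k x} → (q ∸ 1) ∣ d ℕ.* k → x ≢ 0# → (x ^ d) ^ k ≡ 1#
  [x^d]^k≡1 {d} {k} {x} q∸1∣dk x≢0 = trans (^-assocʳ x d k) (q∸1∣n⇒x^n≡1 x≢0 q∸1∣dk)

  [x^d]^[1+k]≡x^d : ∀ {d k} → 1 ≤ d → (q ∸ 1) ∣ d ℕ.* k → ∀ x → (x ^ d) ^ suc k ≡ x ^ d
  [x^d]^[1+k]≡x^d {d} {k} 1≤d q∸1∣dk x with x ≟ 0#
  ... | yes refl = trans (cong (_* (0# ^ d) ^ k) (0^n≡0 1≤d)) (trans (zeroˡ _) (sym (0^n≡0 1≤d)))
  ... | no x≢0 = trans (cong (x ^ d *_) ([x^d]^k≡1 {d} {k} q∸1∣dk x≢0)) (*-identityʳ _)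

  module PowerMap (d k m : ℕ) (1≤d : 1 ≤ d) (bezout : Bézout.Identity m d (q ∸ 1)) (m∣d : m ∣ d)
                  (q∸1≡km : q ∸ 1 ≡ k ℕ.* m) (k<m : k < m) where

    1≤k : 1 ≤ k
    1≤k = ℕ.n≢0⇒n>0 λ { refl → ℕ.<⇒≢ q∸1≥1 (sym q∸1≡km) }

    2≤m : 2 ≤ m
    2≤m = ℕ.≤-trans (s≤s 1≤k) k<m

    1≤m : 1 ≤ m
    1≤m = ℕ.≤-trans (s≤s z≤n) 2≤m

    q∸1∣dk : (q ∸ 1) ∣ d ℕ.* k
    q∸1∣dk = subst (_∣ d ℕ.* k) (trans (ℕ.*-comm m k) (sym q∸1≡km)) (*-monoˡ-∣ k m∣d)

    graph : List Triple
    graph = S (_^ d)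

    vertical-≤ : ∀ c → pointsOn graph (1# , 0# , c) ≤ m
    vertical-≤ c = begin
      pointsOn graph (1# , 0# , c)                ≤⟨ pointsOn-S-≤ (_^ d) _ ⟩
      affinePointsOn (_^ d) (1# , 0# , c) ℕ.+ 1   ≤⟨ ℕ.+-monoˡ-≤ 1 (affinePointsOn-≤-degree (_^ d) _ (c ∷ []) root) ⟩
      2                                           ≤⟨ 2≤m ⟩
      m                                           ∎
      where
        open ℕ.≤-Reasoning
        root : ∀ {x} → incident (1# , 0# , c) (x , x ^ d , 1#) → IsRoot (c ∷ []) x
        root {x} on = trans (solve 3 (λ x y c → c :+ x :* con 1 := con 1 :* x :+ con 0 :* y :+ c) refl x (x ^ d) c)
                            (incident-affine on)

    atInfinity-≤ : pointsOn graph (0# , 0# , 1#) ≤ m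
    atInfinity-≤ = begin
      pointsOn graph (0# , 0# , 1#)                ≤⟨ pointsOn-S-≤ (_^ d) _ ⟩
      affinePointsOn (_^ d) (0# , 0# , 1#) ℕ.+ 1   ≤⟨ ℕ.+-monoˡ-≤ 1 (affinePointsOn-≤-degree (_^ d) _ [] root) ⟩
      1                                            ≤⟨ 1≤m ⟩
      m                                            ∎
      where
        open ℕ.≤-Reasoning
        root : ∀ {x} → incident (0# , 0# , 1#) (x , x ^ d , 1#) → IsRoot [] x
        root {x} on = trans (solve 2 (λ x y → con 1 := con 0 :* x :+ con 0 :* y :+ con 1) refl x (x ^ d)) (incident-affine on)

    fibre-≤ : ∀ {e xs} → Unique xs → All (λ x → x ^ d ≡ e) xs → length xs ≤ m
    fibre-≤ _ [] = z≤n
    fibre-≤ {xs = x₀ ∷ _} xs-unique all@(x₀ᵈ≡e ∷ _) =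
      ^-solutions-≤ 1≤m (x₀ ^ m) xs-unique
        (All.map (λ xᵈ≡e → x^d≡y^d⇒x^m≡y^m 1≤d bezout (trans xᵈ≡e (sym x₀ᵈ≡e))) all)

    horizontal-≤ : ∀ c → pointsOn graph (0# , 1# , c) ≤ m
    horizontal-≤ c = subst (_≤ m) (sym (pointsOn-S-∞∉ (_^ d) _ (1≢0 ∘ incident-∞)))
                       (affinePointsOn-≤ (_^ d) _ (λ xs-unique on → fibre-≤ xs-unique (All.map horizontal-level on)))

    oblique-≤ : ∀ {b} c → b ≢ 0# → pointsOn graph (1# , b , c) ≤ m
    oblique-≤ {b} c b≢0 = subst (_≤ m) (sym (pointsOn-S-∞∉ (_^ d) _ (b≢0 ∘ incident-∞)))
                            (affinePointsOn-≤ (_^ d) _ bound)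
      where
        bound : ∀ {xs} → Unique xs → All (λ x → incident (1# , b , c) (x , x ^ d , 1#)) xs → length xs ≤ m
        bound {xs} xs-unique on = begin
          length xs              ≡⟨ sym (length-map (_^ d) xs) ⟩
          length (map (_^ d) xs) ≤⟨ ^-fixedPoints-≤ 1≤k values-unique
                                       (map⁺ (All.universal ([x^d]^[1+k]≡x^d 1≤d q∸1∣dk) xs)) ⟩
          suc k                  ≤⟨ k<m ⟩
          m                      ∎
          where
            open ℕ.≤-Reasoning
            recover : All (λ x → - (b * x ^ d + c) ≡ x) xs
            recover = All.map (λ {x} on → sym (x+y≡0⇒x≡-y (trans
                        (solve 4 (λ x y b c → x :+ (b :* y :+ c) := con 1 :* x :+ b :* y :+ c) refl x (x ^ d) b c)
                        (incident-affine on)))) on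
            values-unique : Unique (map (_^ d) xs)
            values-unique = Unique.map⁻
              (subst Unique (trans (sym (map-id-local recover)) (map-∘ {g = λ y → - (b * y + c)} xs)) xs-unique)

    lines-≤ : All (λ ℓ → pointsOn graph ℓ ≤ m) lines
    lines-≤ = all-lines [1bc]-≤ horizontal-≤ atInfinity-≤
      where
        [1bc]-≤ : ∀ b c → pointsOn graph (1# , b , c) ≤ m
        [1bc]-≤ b c with b ≟ 0#
        ... | yes refl = vertical-≤ c
        ... | no b≢0 = oblique-≤ c b≢0

    rootsOfUnity : List Carrier
    rootsOfUnity = filter (λ y → (y ^ k) ≟ 1#) elements

    units↦rootsOfUnity : All (λ x → x ^ d ∈ rootsOfUnity) units
    units↦rootsOfUnity =
      All.map (λ x≢0 → ∈-filter⁺ _ (∈-elements _) ([x^d]^k≡1 {d} {k} q∸1∣dk x≢0)) (all-filter nonzero? elements)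

    few-rootsOfUnity : length rootsOfUnity ℕ.* (m ∸ 1) < length units
    few-rootsOfUnity = begin-strict
      length rootsOfUnity ℕ.* (m ∸ 1)  ≤⟨ ℕ.*-monoˡ-≤ (m ∸ 1)
                                            (^-solutions-≤ 1≤k 1# (Unique.filter⁺ _ elements-unique) (all-filter _ elements)) ⟩
      k ℕ.* (m ∸ 1)                    <⟨ ℕ.*-monoʳ-< k {{ℕ.>-nonZero 1≤k}} (ℕ.∸-monoʳ-< (s≤s z≤n) 1≤m) ⟩
      k ℕ.* m                          ≡⟨ sym q∸1≡km ⟩
      q ∸ 1                            ≡⟨ sym length-units ⟩
      length units                     ∎
      where open ℕ.≤-Reasoning

    rich-horizontal : ∃ λ e → m ≤ pointsOn graph (0# , 1# , - e)
    rich-horizontal with pigeonhole _≟_ (_^ d) (m ∸ 1) rootsOfUnity units units↦rootsOfUnity few-rootsOfUnity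
    ... | e , m∸1<fibre = e , (begin
      m                                       ≤⟨ ℕ.m≤n+m∸n m 1 ⟩
      suc (m ∸ 1)                             ≤⟨ m∸1<fibre ⟩
      length (fibre _≟_ (_^ d) e units)       ≤⟨ length-filter-filter _ _ elements ⟩
      length (fibre _≟_ (_^ d) e elements)    ≤⟨ length-filter-mono _ _ on-line elements ⟩
      affinePointsOn (_^ d) (0# , 1# , - e)   ≤⟨ affinePointsOn-≤-pointsOn (_^ d) _ ⟩
      pointsOn graph (0# , 1# , - e)          ∎)
      where
        open ℕ.≤-Reasoning
        on-line : ∀ {x} → x ^ d ≡ e → incident (0# , 1# , - e) (x , x ^ d , 1#)
        on-line {x} xᵈ≡e =
          subst (λ e → incident (0# , 1# , - e) (x , x ^ d , 1#)) xᵈ≡e (horizontal-incident x (x ^ d))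

    deg-graph : deg graph ≡ m
    deg-graph = deg-≡ {graph} lines-≤ ([01c]∈lines (- proj₁ rich-horizontal)) (proj₂ rich-horizontal)

open import Data.Nat using (_*_)

corollary3p8 : (q : ℕ) → IsPrimePower q → (F : FiniteField q) → (d : ℕ) → d ≥ 1 →
    gcd d (q ∸ 1) * (gcd d (q ∸ 1) ∸ 1) ≥ q ∸ 1 →
    FiniteField.deg F (FiniteField.S F (λ x → FiniteField._^_ F x d)) ≡ gcd d (q ∸ 1)
corollary3p8 q _ F d 1≤d m[m∸1]≥q∸1 =
  PowerMap.deg-graph F d k m 1≤d (Bézout.identity (gcd-GCD d (q ∸ 1))) (gcd[m,n]∣m d (q ∸ 1)) q∸1≡km k<m
  where
    m = gcd d (q ∸ 1)
    open _∣_ (gcd[m,n]∣n d (q ∸ 1)) renaming (quotient to k; equality to q∸1≡km)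
    k<m : k < m
    k<m = k*m≤m*[m∸1]⇒k<m k m (subst (0 <_) q∸1≡km (q∸1≥1 F)) (subst (_≤ m ℕ.* (m ∸ 1)) q∸1≡km m[m∸1]≥q∸1)
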